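{- There exist absolute constants $c,C>0$ such that for all positive integers $m,n$, \[c\,mn \leq r_<(NM^<_m,K^<_{n+1}) \leq C\,mn,\] i.e. $r_<(NM^<_m,K^<_{n+1}) = \Theta(mn)$.
   Context: An ordered graph on $N$ vertices is a graph with vertex set $[N]=\{1,\dots,N\}$ ordered by the usual order of integers. An ordered graph $G^<$ on $[n]$ is an ordered subgraph of an ordered graph $H^<$ on $[N]$ if there is a map $\phi:[n]\to[N]$ with $\phi(i)<\phi(j)$ whenever $i<j$ such that $\{\phi(i),\phi(j)\}$ is an edge of $H^<$ whenever $\{i,j\}$ is an edge of $G^<$. $K^<_N$ is the complete ordered graph on $[N]$. For ordered graphs $G^<,H^<$, the ordered Ramsey number $r_<(G^<,H^<)$ is the least $N$ such that every red-blue coloring of the edges of $K^<_N$ contains a red copy of $G^<$ or a blue copy of $H^<$ as an ordered subgraph. For $m\in\mathbb{N}$, the nested matching $NM^<_m$ is the ordered graph on $[2m]$ with edges $\{i,2m-i+1\}$ for $i\in[m]$. -}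

module Defs where

open import Data.Nat using (ℕ; suc; _+_; _*_; _≤_)
open import Data.Fin using (Fin; toℕ; _<_)
open import Data.Bool using (Bool; true; false)
open import Data.Product using (Σ; _×_; ∃)
open import Data.Sum using (_⊎_)
open import Data.Unit using (⊤)
open import Relation.Binary.PropositionalEquality using (_≡_)

-- An ordered graph on [n] (vertices Fin n = {0,…,n-1}, ordered as usual),
-- given by its edge relation; only pairs i < j are ever consulted,
-- E i j (with i < j) meaning {i,j} is an edge.
OrdGraph : ℕ → Set₁
OrdGraph n = Fin n → Fin n → Set

K< : (n : ℕ) → OrdGraph n
K< n i j = ⊤

-- nested matching NM^<_m on [2m]: edges {i, 2m-i+1} (1-indexed),
-- i.e. 0-indexed pairs i < j with i + j + 1 = 2m
NM< : (m : ℕ) → OrdGraph (2 * m)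
NM< m i j = toℕ i + toℕ j + 1 ≡ 2 * m

-- red-blue colourings of the edges of K^<_N: the colour of edge {a,b}
-- with a < b is col a b (true = red, false = blue)
Colouring : ℕ → Set
Colouring N = Fin N → Fin N → Bool

MonoCopy : {n N : ℕ} → Colouring N → Bool → OrdGraph n → Set
MonoCopy {n} {N} col b G =
  Σ (Fin n → Fin N) λ φ →
    (∀ i j → i < j → φ i < φ j) ×
    (∀ i j → i < j → G i j → col (φ i) (φ j) ≡ b)

Arrows : {n k : ℕ} → ℕ → OrdGraph n → OrdGraph k → Set
Arrows N G H = (col : Colouring N) → MonoCopy col true G ⊎ MonoCopy col false H

IsOrdRamsey : {n k : ℕ} → OrdGraph n → OrdGraph k → ℕ → Set
IsOrdRamsey G H r = Arrows r G H × (∀ N → Arrows N G H → r ≤ N)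

-- Lower bound: colour {a, b} (a < b) red iff b − a < m.  The outermost edge of a copy
-- of NM_m joins vertices at least 2m − 1 ≥ m apart, so it is blue; and consecutive
-- vertices of a blue K_{n+1} are at least m apart, so it needs more than nm vertices.
--
-- Upper bound: suppose a colouring of [N] has no red NM_m.  Give each red edge (a, b)
-- the level "largest number of pairwise nested red edges strictly between a and b".
-- Levels are below m, and an edge nested inside another one has smaller level, so no
-- two edges of the same level nest.  Hence a red edge (a, b) of level ℓ is the first
-- level-ℓ edge leaving a, or it comes from the last a′ < b whose level-ℓ edge to b is
-- not the first one leaving a′: otherwise the first level-ℓ edge leaving that a′ would
-- nest inside (a, b).  So every vertex marks at most 2m others and every red edge is
-- marked from one of its ends.  By double counting, every vertex set S has a vertex
-- marking or marked by at most 4m vertices of S; removing it together with those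
-- repeatedly leaves a red-independent set, i.e. a blue clique, of size N / (4m + 1).
-- Thus (n + 1)(4m + 1) ≤ 10mn vertices suffice.  The Ramsey number itself exists
-- because arrowing is decidable by exhaustive search.

module Submission where

open import Defs
open import Data.Nat using (ℕ; zero; suc; _+_; _*_; _≤_; _<_; _∸_; _⊔_; z≤n; s≤s; z<s; s<s; _<ᵇ_; _≟_; _≤?_; _<?_)
open import Data.Nat.Properties
open import Data.Nat.Tactic.RingSolver using (solve-∀)
open import Algebra.Properties.Semiring.Sum +-*-semiring
  using (sum; sum-syntax; ∑-comm; ∑-distrib-+; *-distribˡ-sum; sum-cong-≗)
open import Data.Fin using (Fin; zero; suc; toℕ; fromℕ; fromℕ<) renaming (_<_ to _<ᶠ_)
open import Data.Fin.Properties
  using (toℕ<n; toℕ-fromℕ; toℕ-fromℕ<; fromℕ<-toℕ; toℕ-injective; all?; any?; ¬∀⟶∃¬)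
  renaming (_<?_ to _<ᶠ?_)
open import Data.Bool using (Bool; true; false; T; if_then_else_)
import Data.Bool.Properties as Bool
open import Data.Product using (Σ; _×_; ∃; _,_; proj₁; proj₂)
open import Data.Sum using (_⊎_; inj₁; inj₂; [_,_]′)
open import Data.Unit using (⊤; tt)
open import Data.Empty using (⊥)
open import Function using (_∘_)
open import Relation.Nullary using (¬_; Dec; yes; no; does; ¬?; contradiction)
open import Relation.Nullary.Decidable using (_×-dec_; _→-dec_; _⊎-dec_; decidable-stable)
open import Relation.Unary using (Decidable; _⊆_)
open import Relation.Binary.Definitions using (_Respects_; tri<; tri≈; tri>)
open import Relation.Binary.PropositionalEquality hiding ([_])

-- Deciding arrowing by exhaustive search

-- Without function extensionality, a search over a function space can only be carried
-- out for predicates respecting pointwise equality.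
Searchable : (A : Set) → (A → A → Set) → Set₁
Searchable A _≈_ = (P : A → Set) → P Respects _≈_ → Decidable P → (∀ x → P x) ⊎ ∃ (¬_ ∘ P)

dec-∀ : ∀ {A : Set} {P : A → Set} → (∀ x → P x) ⊎ ∃ (¬_ ∘ P) → Dec (∀ x → P x)
dec-∀ (inj₁ all) = yes all
dec-∀ (inj₂ (x , ¬px)) = no (λ all → ¬px (all x))

searchable-Bool : Searchable Bool _≡_
searchable-Bool P _ P? with P? true | P? false
... | no ¬pt | _ = inj₂ (true , ¬pt)
... | yes _ | no ¬pf = inj₂ (false , ¬pf)
... | yes pt | yes pf = inj₁ λ { true → pt ; false → pf }

searchable-Fin : ∀ n → Searchable (Fin n) _≡_
searchable-Fin n P _ P? with all? P?
... | yes all = inj₁ all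
... | no ¬all = inj₂ (¬∀⟶∃¬ n P P? ¬all)

_∷ᶠ_ : ∀ {A : Set} {k} → A → (Fin k → A) → Fin (suc k) → A
(a ∷ᶠ g) zero = a
(a ∷ᶠ g) (suc i) = g i

searchable-Π : ∀ {A : Set} {_≈_ : A → A → Set} → (∀ {x} → x ≈ x) → Searchable A _≈_ →
               ∀ k → Searchable (Fin k → A) (λ f g → ∀ i → f i ≈ g i)
searchable-Π refl≈ search zero P resp P? with P? (λ ())
... | yes p = inj₁ (λ f → resp (λ ()) p)
... | no ¬p = inj₂ ((λ ()) , ¬p)
searchable-Π {A} {_≈_} refl≈ search (suc k) P resp P? =
  combine (search AllTails resp-tails (dec-∀ ∘ tails))
  where
  AllTails : A → Set
  AllTails a = ∀ g → P (a ∷ᶠ g)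
  tails : ∀ a → AllTails a ⊎ ∃ λ g → ¬ P (a ∷ᶠ g)
  tails a = searchable-Π refl≈ search k (P ∘ (a ∷ᶠ_))
              (λ g≈ → resp λ { zero → refl≈ ; (suc i) → g≈ i }) (P? ∘ (a ∷ᶠ_))
  resp-tails : AllTails Respects _≈_
  resp-tails a≈ all g = resp (λ { zero → a≈ ; (suc i) → refl≈ }) (all g)
  combine : (∀ a → AllTails a) ⊎ ∃ (¬_ ∘ AllTails) → (∀ f → P f) ⊎ ∃ (¬_ ∘ P)
  combine (inj₁ all) = inj₁ λ f → resp (λ { zero → refl≈ ; (suc i) → refl≈ }) (all (f zero) (f ∘ suc))
  combine (inj₂ (a , ¬all)) with tails a
  ... | inj₁ all = contradiction all ¬all
  ... | inj₂ (g , ¬p) = inj₂ (a ∷ᶠ g , ¬p)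

module _ {n N : ℕ} (G : OrdGraph n) (G? : ∀ i j → Dec (G i j)) where

  IsCopy : Colouring N → Bool → (Fin n → Fin N) → Set
  IsCopy col b φ = (∀ i j → i <ᶠ j → φ i <ᶠ φ j) × (∀ i j → i <ᶠ j → G i j → col (φ i) (φ j) ≡ b)

  isCopy? : ∀ col b φ → Dec (IsCopy col b φ)
  isCopy? col b φ =
    all? (λ i → all? λ j → i <ᶠ? j →-dec φ i <ᶠ? φ j) ×-dec
    all? (λ i → all? λ j → i <ᶠ? j →-dec (G? i j →-dec col (φ i) (φ j) Bool.≟ b))

  monoCopy? : ∀ col b → Dec (MonoCopy col b G)
  monoCopy? col b =
    fromSearch (searchable-Π refl (searchable-Fin N) n (¬_ ∘ IsCopy col b) ¬copy-resp (¬? ∘ isCopy? col b))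
    where
    ¬copy-resp : (¬_ ∘ IsCopy col b) Respects (λ φ ψ → ∀ i → φ i ≡ ψ i)
    ¬copy-resp φ≗ψ ¬copy (inc , edges) = ¬copy
      ( (λ i j lt → subst₂ _<ᶠ_ (sym (φ≗ψ i)) (sym (φ≗ψ j)) (inc i j lt))
      , (λ i j lt e → trans (cong₂ col (φ≗ψ i) (φ≗ψ j)) (edges i j lt e)) )
    fromSearch : (∀ φ → ¬ IsCopy col b φ) ⊎ ∃ (¬_ ∘ ¬_ ∘ IsCopy col b) → Dec (MonoCopy col b G)
    fromSearch (inj₁ none) = no λ { (φ , copy) → none φ copy }
    fromSearch (inj₂ (φ , ¬¬copy)) = yes (φ , decidable-stable (isCopy? col b φ) ¬¬copy)

  monoCopy-resp : ∀ {col col′ : Colouring N} {b} → (∀ i j → col i j ≡ col′ i j) →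
                  MonoCopy col b G → MonoCopy col′ b G
  monoCopy-resp col≗ (φ , inc , edges) = φ , inc , λ i j lt e → trans (sym (col≗ (φ i) (φ j))) (edges i j lt e)

arrows? : ∀ {n k} N (G : OrdGraph n) (H : OrdGraph k) →
          (∀ i j → Dec (G i j)) → (∀ i j → Dec (H i j)) → Dec (Arrows N G H)
arrows? N G H G? H? = dec-∀ (searchable-Π (λ _ → refl) (searchable-Π refl searchable-Bool N) N
  (λ col → MonoCopy col true G ⊎ MonoCopy col false H)
  (λ { col≗ (inj₁ red) → inj₁ (monoCopy-resp G G? col≗ red)
     ; col≗ (inj₂ blue) → inj₂ (monoCopy-resp H H? col≗ blue) })
  (λ col → monoCopy? G G? col true ⊎-dec monoCopy? H H? col false))

module _ {P : ℕ → Set} (P? : Decidable P) where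

  firstFrom : ℕ → ℕ → ℕ
  firstFrom x zero = x
  firstFrom x (suc d) with P? x
  ... | yes _ = x
  ... | no _ = firstFrom (suc x) d

  firstFrom-spec : ∀ x d {y} → x ≤ y → y < x + d → P y → x ≤ firstFrom x d × firstFrom x d ≤ y × P (firstFrom x d)
  firstFrom-spec x zero x≤y y<x+0 _ =
    contradiction (≤-<-trans x≤y (subst (_ <_) (+-identityʳ x) y<x+0)) (<-irrefl refl)
  firstFrom-spec x (suc d) {y} x≤y y<x+d py with P? x
  ... | yes px = ≤-refl , x≤y , px
  ... | no ¬px with m≤n⇒m<n∨m≡n x≤y
  ...   | inj₂ refl = contradiction py ¬px
  ...   | inj₁ x<y with firstFrom-spec (suc x) d x<y (subst (y <_) (+-suc x d) y<x+d) py
  ...     | x<f , f≤y , pf = <⇒≤ x<f , f≤y , pf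

  lastBelow : ℕ → ℕ
  lastBelow zero = 0
  lastBelow (suc b) with P? b
  ... | yes _ = b
  ... | no _ = lastBelow b

  lastBelow-spec : ∀ b {y} → y < b → P y → y ≤ lastBelow b × lastBelow b < b × P (lastBelow b)
  lastBelow-spec (suc b) {y} (s≤s y≤b) py with P? b
  ... | yes pb = y≤b , ≤-refl , pb
  ... | no ¬pb with m≤n⇒m<n∨m≡n y≤b
  ...   | inj₂ refl = contradiction py ¬pb
  ...   | inj₁ y<b with lastBelow-spec b y<b py
  ...     | y≤l , l<b , pl = y≤l , m≤n⇒m≤1+n l<b , pl

  least : ∀ U → P U → ∃ λ r → P r × (∀ k → P k → r ≤ k) × r ≤ U
  least U pU with firstFrom-spec 0 (suc U) z≤n ≤-refl pU
  ... | _ , r≤U , pr = firstFrom 0 (suc U) , pr , minimal , r≤U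
    where
    minimal : ∀ k → P k → firstFrom 0 (suc U) ≤ k
    minimal k pk with ≤-total k U
    ... | inj₁ k≤U = proj₁ (proj₂ (firstFrom-spec 0 (suc U) z≤n (s≤s k≤U) pk))
    ... | inj₂ U≤k = ≤-trans r≤U U≤k

ordRamsey-exists : ∀ {n k} {G : OrdGraph n} {H : OrdGraph k} → (∀ i j → Dec (G i j)) → (∀ i j → Dec (H i j)) →
                   ∀ U → Arrows U G H → Σ ℕ λ r → IsOrdRamsey G H r × r ≤ U
ordRamsey-exists {G = G} {H} G? H? U arrows-U =
  let r , arrows-r , minimal , r≤U = least (λ N → arrows? N G H G? H?) U arrows-U
  in r , (arrows-r , minimal) , r≤U

-- The lower bound

spread : ∀ {k N} s (φ : Fin (suc k) → Fin N) → (∀ i j → i <ᶠ j → toℕ (φ i) + s ≤ toℕ (φ j)) →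
         ∀ i → toℕ (φ zero) + toℕ i * s ≤ toℕ (φ i)
spread s φ gap zero = ≤-reflexive (+-identityʳ _)
spread {suc k} s φ gap (suc i) = begin
  toℕ (φ zero) + (s + toℕ i * s) ≡⟨ +-assoc (toℕ (φ zero)) s _ ⟨
  toℕ (φ zero) + s + toℕ i * s   ≤⟨ +-monoˡ-≤ (toℕ i * s) (gap zero (suc zero) z<s) ⟩
  toℕ (φ (suc zero)) + toℕ i * s ≤⟨ spread s (φ ∘ suc) (λ i j → gap (suc i) (suc j) ∘ s<s) i ⟩
  toℕ (φ (suc i))                ∎
  where open ≤-Reasoning

shortRed : ∀ {N} → ℕ → Colouring N
shortRed m a b = toℕ b <ᵇ toℕ a + m

shortRed-¬NM : ∀ {N a} → ¬ MonoCopy (shortRed {N} (suc a)) true (NM< (suc a))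
shortRed-¬NM {a = a} (φ , inc , edges) = <-irrefl refl (begin-strict
  toℕ (φ last)                 <⟨ <ᵇ⇒< _ _ (subst T (sym (edges zero last 0<last outer)) tt) ⟩
  toℕ (φ zero) + suc a         ≤⟨ +-monoʳ-≤ (toℕ (φ zero)) a<last ⟩
  toℕ (φ zero) + toℕ last * 1  ≤⟨ spread 1 φ (λ i j lt → ≤-trans (≤-reflexive (+-comm _ 1)) (inc i j lt)) last ⟩
  toℕ (φ last)                 ∎)
  where
  open ≤-Reasoning
  last : Fin (2 * suc a)
  last = fromℕ (a + suc (a + 0))
  0<last : zero {n = a + suc (a + 0)} <ᶠ last
  0<last = subst (0 <_) (sym (toℕ-fromℕ _)) (≤-trans z<s (m≤n+m (suc (a + 0)) a))
  outer : toℕ last + 1 ≡ 2 * suc a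
  outer = trans (cong (_+ 1) (toℕ-fromℕ _)) (+-comm _ 1)
  a<last : suc a ≤ toℕ last * 1
  a<last = ≤-trans (m≤n+m (suc a) a) (≤-reflexive (begin-equality
    a + suc a         ≡⟨ cong (λ x → a + suc x) (+-identityʳ a) ⟨
    a + suc (a + 0)   ≡⟨ toℕ-fromℕ _ ⟨
    toℕ last          ≡⟨ *-identityʳ _ ⟨
    toℕ last * 1      ∎))

shortRed-¬K : ∀ {N m n} → N ≤ n * m → ¬ MonoCopy (shortRed {N} m) false (K< (suc n))
shortRed-¬K {N} {m} {n} N≤nm (ψ , inc , edges) = <-irrefl refl (begin-strict
  n * m                            ≤⟨ m≤n+m _ (toℕ (ψ zero)) ⟩
  toℕ (ψ zero) + n * m             ≡⟨ cong (λ i → toℕ (ψ zero) + i * m) (toℕ-fromℕ n) ⟨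
  toℕ (ψ zero) + toℕ (fromℕ n) * m ≤⟨ spread m ψ far-apart (fromℕ n) ⟩
  toℕ (ψ (fromℕ n))                <⟨ toℕ<n (ψ (fromℕ n)) ⟩
  N                                ≤⟨ N≤nm ⟩
  n * m                            ∎)
  where
  open ≤-Reasoning
  far-apart : ∀ i j → i <ᶠ j → toℕ (ψ i) + m ≤ toℕ (ψ j)
  far-apart i j i<j = ≮⇒≥ λ close → subst T (edges i j i<j tt) (<⇒<ᵇ close)

¬arrows-small : ∀ {m n N} → 1 ≤ m → N ≤ n * m → ¬ Arrows N (NM< m) (K< (suc n))
¬arrows-small {suc a} _ N≤nm arrows = [ shortRed-¬NM , shortRed-¬K N≤nm ]′ (arrows (shortRed (suc a)))

-- Separated sets of a weighted graph

-- Only `does` is inspected, so that [ suc a ≟ suc b ] reduces to [ a ≟ b ].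
[_] : ∀ {A : Set} → Dec A → ℕ
[ a? ] = if does a? then 1 else 0

[]*-≤ : ∀ {A : Set} (a? : Dec A) x → [ a? ] * x ≤ x
[]*-≤ (yes _) x = ≤-reflexive (*-identityˡ x)
[]*-≤ (no _) x = z≤n

[]-remove : ∀ {A B : Set} (a? : Dec A) (b? : Dec B) c →
            [ a? ] ≤ [ a? ×-dec ¬? b? ×-dec c ≟ 0 ] + ([ b? ] + [ a? ] * c)
[]-remove (no _) _ _ = z≤n
[]-remove (yes _) (yes _) _ = s≤s z≤n
[]-remove (yes _) (no _) zero = s≤s z≤n
[]-remove (yes _) (no _) (suc c) = s≤s z≤n

[]-⊎ : ∀ {A B : Set} (a? : Dec A) (b? : Dec B) → ¬ (A × B) → [ a? ] + [ b? ] ≤ [ a? ⊎-dec b? ]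
[]-⊎ (yes a) (yes b) ¬ab = contradiction (a , b) ¬ab
[]-⊎ (yes _) (no _) _ = ≤-refl
[]-⊎ (no _) (yes _) _ = ≤-refl
[]-⊎ (no _) (no _) _ = ≤-refl

[]-yes : ∀ {A : Set} (a? : Dec A) → A → [ a? ] ≡ 1
[]-yes (yes _) _ = refl
[]-yes (no ¬a) a = contradiction a ¬a

∣_∣ : ∀ {N} {S : Fin N → Set} → Decidable S → ℕ
∣_∣ {N} S? = ∑[ u < N ] [ S? u ]

∑-mono-≤ : ∀ {n} {f g : Fin n → ℕ} → (∀ i → f i ≤ g i) → sum f ≤ sum g
∑-mono-≤ {zero} _ = z≤n
∑-mono-≤ {suc n} f≤g = +-mono-≤ (f≤g zero) (∑-mono-≤ (f≤g ∘ suc))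

∑-const : ∀ n c → ∑[ i < n ] c ≡ n * c
∑-const zero c = refl
∑-const (suc n) c = cong (c +_) (∑-const n c)

∑-zero : ∀ n → ∑[ i < n ] 0 ≡ 0
∑-zero n = trans (∑-const n 0) (*-zeroʳ n)

term≤∑ : ∀ {n} (f : Fin n → ℕ) i → f i ≤ sum f
term≤∑ f zero = m≤m+n _ _
term≤∑ f (suc i) = ≤-trans (term≤∑ (f ∘ suc) i) (m≤n+m _ (f zero))

∑-point : ∀ n c → ∑[ u < n ] [ toℕ u ≟ c ] ≤ 1
∑-point zero c = z≤n
∑-point (suc n) zero = ≤-reflexive (cong suc (∑-zero n))
∑-point (suc n) (suc c) = ∑-point n c

∑-point-< : ∀ {n c} → c < n → ∑[ u < n ] [ toℕ u ≟ c ] ≡ 1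
∑-point-< {suc n} {zero} _ = cong suc (∑-zero n)
∑-point-< {suc n} {suc c} (s≤s c<n) = ∑-point-< c<n

module _ {N d : ℕ} (w : Fin N → Fin N → ℕ) (w-row : ∀ v → ∑[ u < N ] w v u ≤ d) where

  Separated : (Fin N → Set) → Set
  Separated T = ∀ {u v} → T u → T v → toℕ u ≢ toℕ v → w u v ≡ 0

  module _ {S : Fin N → Set} (S? : Decidable S) where

    charge : Fin N → ℕ
    charge v = ∑[ u < N ] ([ S? u ] * (w v u + w u v))

    private
      share : Fin N → Fin N → ℕ
      share v u = [ S? v ] * ([ S? u ] * w v u)

      pairs : ℕ
      pairs = ∑[ v < N ] ∑[ u < N ] share v u

      pairs≤ : pairs ≤ d * ∣ S? ∣
      pairs≤ = begin
        pairs                                                ≡⟨ sum-cong-≗ (λ v → *-distribˡ-sum [ S? v ] (row-terms v)) ⟨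
        ∑[ v < N ] ([ S? v ] * ∑[ u < N ] ([ S? u ] * w v u)) ≤⟨ ∑-mono-≤ (λ v → *-monoʳ-≤ [ S? v ] (row v)) ⟩
        ∑[ v < N ] ([ S? v ] * d)                            ≡⟨ sum-cong-≗ (λ v → *-comm [ S? v ] d) ⟩
        ∑[ v < N ] (d * [ S? v ])                            ≡⟨ *-distribˡ-sum d (λ v → [ S? v ]) ⟨
        d * ∣ S? ∣                                           ∎
        where
        open ≤-Reasoning
        row-terms : Fin N → Fin N → ℕ
        row-terms v u = [ S? u ] * w v u
        row : ∀ v → ∑[ u < N ] ([ S? u ] * w v u) ≤ d
        row v = ≤-trans (∑-mono-≤ (λ u → []*-≤ (S? u) (w v u))) (w-row v)

    charge-total : ∑[ v < N ] ([ S? v ] * charge v) ≤ 2 * d * ∣ S? ∣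
    charge-total = begin
      ∑[ v < N ] ([ S? v ] * charge v)               ≡⟨ sum-cong-≗ expand ⟩
      ∑[ v < N ] ∑[ u < N ] (share v u + share u v) ≡⟨ trans (sum-cong-≗ λ v → ∑-distrib-+ (share v) (λ u → share u v))
                                                        (∑-distrib-+ (λ v → ∑[ u < N ] share v u) _) ⟩
      pairs + ∑[ v < N ] ∑[ u < N ] share u v       ≡⟨ cong (pairs +_) (∑-comm (λ v u → share u v)) ⟩
      pairs + pairs                                  ≤⟨ +-mono-≤ pairs≤ pairs≤ ⟩
      d * ∣ S? ∣ + d * ∣ S? ∣                        ≡⟨ twice d ∣ S? ∣ ⟩
      2 * d * ∣ S? ∣                                 ∎
      where
      open ≤-Reasoning
      split : ∀ s t x y → s * (t * (x + y)) ≡ s * (t * x) + t * (s * y)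
      split = solve-∀
      expand : ∀ v → [ S? v ] * charge v ≡ ∑[ u < N ] (share v u + share u v)
      expand v = trans (*-distribˡ-sum [ S? v ] (λ u → [ S? u ] * (w v u + w u v)))
                       (sum-cong-≗ λ u → split [ S? v ] [ S? u ] (w v u) (w u v))
      twice : ∀ x y → x * y + x * y ≡ 2 * x * y
      twice = solve-∀

    low-charge : 1 ≤ ∣ S? ∣ → ∃ λ v → S v × charge v ≤ 2 * d
    low-charge nonempty with any? (λ v → S? v ×-dec charge v ≤? 2 * d)
    ... | yes found = found
    ... | no none = contradiction charge-total (<⇒≱ (begin-strict
      2 * d * ∣ S? ∣                       <⟨ m<n+m _ nonempty ⟩
      suc (2 * d) * ∣ S? ∣                 ≡⟨ *-distribˡ-sum (suc (2 * d)) (λ v → [ S? v ]) ⟩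
      ∑[ v < N ] (suc (2 * d) * [ S? v ])  ≤⟨ ∑-mono-≤ heavy ⟩
      ∑[ v < N ] ([ S? v ] * charge v)     ∎))
      where
      open ≤-Reasoning
      heavy : ∀ v → suc (2 * d) * [ S? v ] ≤ [ S? v ] * charge v
      heavy v with S? v
      ... | no _ = ≤-reflexive (*-zeroʳ (suc (2 * d)))
      ... | yes s = ≤-trans (≤-reflexive (*-comm (suc (2 * d)) 1))
                            (*-monoʳ-≤ 1 (≰⇒> λ c≤ → none (v , s , c≤)))

    Remaining : Fin N → Fin N → Set
    Remaining v u = S u × toℕ u ≢ toℕ v × w v u + w u v ≡ 0

    remaining? : ∀ v → Decidable (Remaining v)
    remaining? v u = S? u ×-dec ¬? (toℕ u ≟ toℕ v) ×-dec (w v u + w u v ≟ 0)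

    remaining-large : ∀ v → charge v ≤ 2 * d → ∣ S? ∣ ≤ ∣ remaining? v ∣ + suc (2 * d)
    remaining-large v low = begin
      ∣ S? ∣                                                          ≤⟨ ∑-mono-≤ removed ⟩
      ∑[ u < N ] ([ remaining? v u ] + (isV u + pair u))              ≡⟨ split ⟩
      ∣ remaining? v ∣ + (∑[ u < N ] [ toℕ u ≟ toℕ v ] + charge v)     ≤⟨ +-monoʳ-≤ ∣ remaining? v ∣
                                                                           (+-mono-≤ (∑-point N (toℕ v)) low) ⟩
      ∣ remaining? v ∣ + suc (2 * d)                                  ∎
      where
      open ≤-Reasoning
      isV pair : Fin N → ℕ
      isV u = [ toℕ u ≟ toℕ v ]
      pair u = [ S? u ] * (w v u + w u v)
      removed : ∀ u → [ S? u ] ≤ [ remaining? v u ] + (isV u + pair u)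
      removed u = []-remove (S? u) (toℕ u ≟ toℕ v) (w v u + w u v)
      split : ∑[ u < N ] ([ remaining? v u ] + (isV u + pair u)) ≡ ∣ remaining? v ∣ + (sum isV + sum pair)
      split = trans (∑-distrib-+ (λ u → [ remaining? v u ]) _) (cong (∣ remaining? v ∣ +_) (∑-distrib-+ isV pair))

  record LargeSeparated (S : Fin N → Set) (k : ℕ) : Set₁ where
    field
      X : Fin N → Set
      X? : Decidable X
      X⊆S : X ⊆ S
      large : k ≤ ∣ X? ∣
      separated : Separated X

  large-separated : ∀ k {S} (S? : Decidable S) → k * suc (2 * d) ≤ ∣ S? ∣ → LargeSeparated S k
  large-separated zero S? _ =
    record { X = λ _ → ⊥ ; X? = λ _ → no λ () ; X⊆S = λ () ; large = z≤n ; separated = λ () }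
  large-separated (suc k) {S} S? big with low-charge S? (≤-trans (m≤m+n 1 _) big)
  ... | v , sv , low = record { X = X ; X? = X? ; X⊆S = X⊆S ; large = large ; separated = separated }
    where
    R : LargeSeparated (Remaining S? v) k
    R = large-separated k (remaining? S? v) (+-cancelˡ-≤ (suc (2 * d)) _ _
          (≤-trans big (≤-trans (remaining-large S? v low) (≤-reflexive (+-comm _ (suc (2 * d)))))))
    module R = LargeSeparated R
    X : Fin N → Set
    X u = R.X u ⊎ toℕ u ≡ toℕ v
    X? : Decidable X
    X? u = R.X? u ⊎-dec (toℕ u ≟ toℕ v)
    X⊆S : X ⊆ S
    X⊆S (inj₁ t) = proj₁ (R.X⊆S t)
    X⊆S (inj₂ u≡v) = subst S (sym (toℕ-injective u≡v)) sv
    joined : ∀ u → [ R.X? u ] + [ toℕ u ≟ toℕ v ] ≤ [ X? u ]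
    joined u = []-⊎ (R.X? u) (toℕ u ≟ toℕ v) λ (t , u≡v) → proj₁ (proj₂ (R.X⊆S t)) u≡v
    large : suc k ≤ ∣ X? ∣
    large = begin
      suc k                                          ≡⟨ +-comm 1 k ⟩
      k + 1                                          ≤⟨ +-mono-≤ R.large (≤-reflexive (sym (∑-point-< (toℕ<n v)))) ⟩
      ∣ R.X? ∣ + ∑[ u < N ] [ toℕ u ≟ toℕ v ]        ≡⟨ ∑-distrib-+ (λ u → [ R.X? u ]) _ ⟨
      ∑[ u < N ] ([ R.X? u ] + [ toℕ u ≟ toℕ v ])    ≤⟨ ∑-mono-≤ joined ⟩
      ∣ X? ∣                                         ∎
      where open ≤-Reasoning
    separated : Separated X
    separated (inj₁ t) (inj₁ t′) u≢u′ = R.separated t t′ u≢u′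
    separated (inj₁ t) (inj₂ u′≡v) _ rewrite toℕ-injective u′≡v = m+n≡0⇒n≡0 _ (proj₂ (proj₂ (R.X⊆S t)))
    separated (inj₂ u≡v) (inj₁ t′) _ rewrite toℕ-injective u≡v = m+n≡0⇒m≡0 _ (proj₂ (proj₂ (R.X⊆S t′)))
    separated (inj₂ u≡v) (inj₂ u′≡v) u≢u′ = contradiction (trans u≡v (sym u′≡v)) u≢u′

Ascending : ∀ {N} → (Fin N → Set) → ℕ → Set
Ascending {N} X k = Σ (Fin k → Fin N) λ φ → (∀ i j → i <ᶠ j → φ i <ᶠ φ j) × (∀ i → X (φ i))

ascending-cons : ∀ {N} {X : Fin (suc N) → Set} {X∘suc? : Decidable (X ∘ suc)} (x? : Dec (X zero)) →
                 (∀ k → k ≤ ∣ X∘suc? ∣ → Ascending (X ∘ suc) k) → ∀ k → k ≤ [ x? ] + ∣ X∘suc? ∣ → Ascending X k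
ascending-cons (no _) rest k k≤ with rest k k≤
... | φ , mono , inX = suc ∘ φ , (λ i j → s<s ∘ mono i j) , inX
ascending-cons (yes _) rest zero _ = (λ ()) , (λ ()) , (λ ())
ascending-cons {X = X} (yes x₀) rest (suc k) (s≤s k≤) with rest k k≤
... | φ , mono , inX = φ′ , mono′ , inX′
  where
  φ′ : Fin (suc k) → Fin _
  φ′ zero = zero
  φ′ (suc i) = suc (φ i)
  mono′ : ∀ i j → i <ᶠ j → φ′ i <ᶠ φ′ j
  mono′ zero (suc j) _ = z<s
  mono′ (suc i) (suc j) (s<s i<j) = s<s (mono i j i<j)
  inX′ : ∀ i → X (φ′ i)
  inX′ zero = x₀
  inX′ (suc i) = inX i

ascending : ∀ {N} {X : Fin N → Set} (X? : Decidable X) k → k ≤ ∣ X? ∣ → Ascending X k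
ascending {zero} X? zero _ = (λ ()) , (λ ()) , (λ ())
ascending {suc N} {X} X? = ascending-cons {X = X} {X? ∘ suc} (X? zero) (ascending (X? ∘ suc))

-- Nested red edges and their levels

∸-split : ∀ {a b c} → a ≤ b → b ≤ c → (b ∸ a) + (c ∸ b) ≡ c ∸ a
∸-split z≤n b≤c = m+[n∸m]≡n b≤c
∸-split (s≤s a≤b) (s≤s b≤c) = ∸-split a≤b b≤c

≤⊔-cases : ∀ {t} p q → t ≤ p ⊔ q → t ≤ p ⊎ t ≤ q
≤⊔-cases {t} p q t≤p⊔q = [ (λ e → inj₁ (subst (t ≤_) e t≤p⊔q)) , (λ e → inj₂ (subst (t ≤_) e t≤p⊔q)) ]′ (⊔-sel p q)

module Nesting (red : ℕ → ℕ → Bool) where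

  -- The largest number of pairwise nested red edges inside [x, x + k).
  depth : ℕ → ℕ → ℕ
  depth x zero = 0
  depth x (suc zero) = 0
  depth x (suc (suc k)) =
    depth (suc x) (suc k) ⊔ depth x (suc k) ⊔ (if red x (x + suc k) then suc (depth (suc x) k) else 0)

  depth-≤-suc : ∀ x k → depth x k ≤ depth x (suc k)
  depth-≤-suc x zero = z≤n
  depth-≤-suc x (suc k) = ≤-trans (m≤n⊔m (depth (suc x) (suc k)) _) (m≤m⊔n _ _)

  depth-suc-≤ : ∀ x k → depth (suc x) k ≤ depth x (suc k)
  depth-suc-≤ x zero = z≤n
  depth-suc-≤ x (suc k) = ≤-trans (m≤m⊔n _ (depth x (suc k))) (m≤m⊔n _ _)

  depth-outer : ∀ x k → red x (x + suc k) ≡ true → suc (depth (suc x) k) ≤ depth x (suc (suc k))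
  depth-outer x k red-x rewrite red-x = m≤n⊔m _ _

  depth-monoʳ : ∀ x {k k′} → k ≤ k′ → depth x k ≤ depth x k′
  depth-monoʳ x {k′ = zero} z≤n = ≤-refl
  depth-monoʳ x {k′ = suc k′} k≤ with m≤n⇒m<n∨m≡n k≤
  ... | inj₁ (s≤s k≤k′) = ≤-trans (depth-monoʳ x k≤k′) (depth-≤-suc x k′)
  ... | inj₂ refl = ≤-refl

  depth-shift : ∀ d x k → depth (d + x) k ≤ depth x (d + k)
  depth-shift zero x k = ≤-refl
  depth-shift (suc d) x k = begin
    depth (suc d + x) k   ≡⟨ cong (λ y → depth y k) (+-suc d x) ⟨
    depth (d + suc x) k   ≤⟨ depth-shift d (suc x) k ⟩
    depth (suc x) (d + k) ≤⟨ depth-suc-≤ x (d + k) ⟩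
    depth x (suc d + k)   ∎
    where open ≤-Reasoning

  depthIn : ℕ → ℕ → ℕ
  depthIn lo hi = depth lo (hi ∸ lo)

  depthIn-mono : ∀ {lo hi lo′ hi′} → lo ≤ lo′ → hi′ ≤ hi → depthIn lo′ hi′ ≤ depthIn lo hi
  depthIn-mono {lo} {hi} {lo′} {hi′} lo≤lo′ hi′≤hi with ≤-total lo′ hi′
  ... | inj₂ hi′≤lo′ = subst (λ k → depth lo′ k ≤ depthIn lo hi) (sym (m≤n⇒m∸n≡0 hi′≤lo′)) z≤n
  ... | inj₁ lo′≤hi′ = begin
    depth lo′ (hi′ ∸ lo′)         ≡⟨ cong (λ y → depth y (hi′ ∸ lo′)) (m∸n+n≡m lo≤lo′) ⟨
    depth (d + lo) (hi′ ∸ lo′)    ≤⟨ depth-shift d lo (hi′ ∸ lo′) ⟩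
    depth lo (d + (hi′ ∸ lo′))    ≡⟨ cong (depth lo) (∸-split lo≤lo′ lo′≤hi′) ⟩
    depth lo (hi′ ∸ lo)           ≤⟨ depth-monoʳ lo (∸-monoˡ-≤ lo hi′≤hi) ⟩
    depth lo (hi ∸ lo)            ∎
    where
    open ≤-Reasoning
    d : ℕ
    d = lo′ ∸ lo

  depthIn-+ : ∀ x k → depthIn x (x + k) ≡ depth x k
  depthIn-+ x k = cong (depth x) (m+n∸m≡n x k)

  depthIn-edge : ∀ {lo hi a b} → lo ≤ a → a < b → b < hi → red a b ≡ true →
                 suc (depthIn (suc a) b) ≤ depthIn lo hi
  depthIn-edge {lo} {hi} {a} {b} lo≤a a<b b<hi red-ab = ≤-trans
    (subst (λ b → red a b ≡ true → suc (depthIn (suc a) b) ≤ depthIn a (suc b)) (m+[n∸m]≡n a<b) (outer _) red-ab)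
    (depthIn-mono lo≤a b<hi)
    where
    outer : ∀ k → red a (suc a + k) ≡ true → suc (depthIn (suc a) (suc a + k)) ≤ depthIn a (suc (suc a + k))
    outer k red-ak = begin
      suc (depthIn (suc a) (suc a + k)) ≡⟨ cong suc (depthIn-+ (suc a) k) ⟩
      suc (depth (suc a) k)             ≤⟨ depth-outer a k (subst (λ b → red a b ≡ true) (sym (+-suc a k)) red-ak) ⟩
      depth a (suc (suc k))             ≡⟨ depthIn-+ a (suc (suc k)) ⟨
      depthIn a (a + suc (suc k))       ≡⟨ cong (depthIn a) (trans (+-suc a (suc k)) (cong suc (+-suc a k))) ⟩
      depthIn a (suc (suc a + k))       ∎
      where open ≤-Reasoning

  record Nested (t lo hi : ℕ) : Set where
    field
      left right : ℕ → ℕ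
      lo≤left    : ∀ {i} → i < t → lo ≤ left i
      left<right : ∀ {i} → i < t → left i < right i
      right<hi   : ∀ {i} → i < t → right i < hi
      red-edge   : ∀ {i} → i < t → red (left i) (right i) ≡ true
      left-mono  : ∀ {i j} → i < j → j < t → left i < left j
      right-anti : ∀ {i j} → i < j → j < t → right j < right i

  nested-zero : ∀ {lo hi} → Nested 0 lo hi
  nested-zero = record
    { left = λ _ → 0 ; right = λ _ → 0
    ; lo≤left = λ () ; left<right = λ () ; right<hi = λ () ; red-edge = λ ()
    ; left-mono = λ _ () ; right-anti = λ _ () }

  nested-widen : ∀ {t lo hi lo′ hi′} → lo′ ≤ lo → hi ≤ hi′ → Nested t lo hi → Nested t lo′ hi′
  nested-widen lo′≤lo hi≤hi′ n = record
    { left = left ; right = right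
    ; lo≤left = ≤-trans lo′≤lo ∘ lo≤left ; left<right = left<right
    ; right<hi = λ i<t → <-≤-trans (right<hi i<t) hi≤hi′ ; red-edge = red-edge
    ; left-mono = left-mono ; right-anti = right-anti }
    where open Nested n

  nested-enclose : ∀ {t x y hi} → red x y ≡ true → x < y → y < hi → Nested t (suc x) y → Nested (suc t) x hi
  nested-enclose {t} {x} {y} {hi} red-xy x<y y<hi n = record
    { left = left′ ; right = right′
    ; lo≤left = lo≤left′ ; left<right = left<right′ ; right<hi = right<hi′ ; red-edge = red-edge′
    ; left-mono = left-mono′ ; right-anti = right-anti′ }
    where
    open Nested n
    left′ right′ : ℕ → ℕ
    left′ zero = x
    left′ (suc i) = left i
    right′ zero = y
    right′ (suc i) = right i
    lo≤left′ : ∀ {i} → i < suc t → x ≤ left′ i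
    lo≤left′ {zero} _ = ≤-refl
    lo≤left′ {suc i} (s≤s i<t) = <⇒≤ (lo≤left i<t)
    left<right′ : ∀ {i} → i < suc t → left′ i < right′ i
    left<right′ {zero} _ = x<y
    left<right′ {suc i} (s≤s i<t) = left<right i<t
    right<hi′ : ∀ {i} → i < suc t → right′ i < hi
    right<hi′ {zero} _ = y<hi
    right<hi′ {suc i} (s≤s i<t) = <-trans (right<hi i<t) y<hi
    red-edge′ : ∀ {i} → i < suc t → red (left′ i) (right′ i) ≡ true
    red-edge′ {zero} _ = red-xy
    red-edge′ {suc i} (s≤s i<t) = red-edge i<t
    left-mono′ : ∀ {i j} → i < j → j < suc t → left′ i < left′ j
    left-mono′ {zero} {suc j} _ (s≤s j<t) = lo≤left j<t
    left-mono′ {suc i} {suc j} (s≤s i<j) (s≤s j<t) = left-mono i<j j<t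
    right-anti′ : ∀ {i j} → i < j → j < suc t → right′ j < right′ i
    right-anti′ {zero} {suc j} _ (s≤s j<t) = right<hi j<t
    right-anti′ {suc i} {suc j} (s≤s i<j) (s≤s j<t) = right-anti i<j j<t

  NestedUpTo : ℕ → ℕ → Set
  NestedUpTo x k = ∀ t → t ≤ depth x k → Nested t x (x + k)

  nested-step : ∀ k x → NestedUpTo (suc x) (suc k) → NestedUpTo x (suc k) → NestedUpTo (suc x) k →
                NestedUpTo x (suc (suc k))
  nested-step k x inner prefix enclosed t t≤depth
    with ≤⊔-cases (depth (suc x) (suc k) ⊔ depth x (suc k)) _ t≤depth
  ... | inj₁ t≤ with ≤⊔-cases (depth (suc x) (suc k)) _ t≤
  ...   | inj₁ t≤inner = nested-widen (n≤1+n x) (≤-reflexive (sym (+-suc x (suc k)))) (inner t t≤inner)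
  ...   | inj₂ t≤prefix = nested-widen ≤-refl (+-monoʳ-≤ x (n≤1+n (suc k))) (prefix t t≤prefix)
  nested-step k x inner prefix enclosed t t≤depth | inj₂ t≤enclosing with red x (x + suc k) in red-x | t
  ... | false | _ = subst (λ t → Nested t x _) (sym (n≤0⇒n≡0 t≤enclosing)) nested-zero
  ... | true | zero = nested-zero
  ... | true | suc t′ = nested-enclose red-x (m<m+n x z<s) (+-monoʳ-< x (n<1+n (suc k)))
    (subst (Nested t′ (suc x)) (sym (+-suc x k)) (enclosed t′ (≤-pred t≤enclosing)))

  depth-nested : ∀ x k → NestedUpTo x k
  depth-nested x zero zero _ = nested-zero
  depth-nested x (suc zero) zero _ = nested-zero
  depth-nested x (suc (suc k)) =
    nested-step k x (depth-nested (suc x) (suc k)) (depth-nested x (suc k)) (depth-nested (suc x) k)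

  module _ {t lo hi} (n : Nested t lo hi) where
    open Nested n

    nested-cross : ∀ {i j} → i < t → j < t → left i < right j
    nested-cross {i} {j} i<t j<t with <-cmp i j
    ... | tri< i<j _ _ = <-trans (left-mono i<j j<t) (left<right j<t)
    ... | tri≈ _ refl _ = left<right i<t
    ... | tri> _ _ j<i = <-trans (left<right i<t) (right-anti j<i i<t)

module Levels (red : ℕ → ℕ → Bool) {N m : ℕ} (shallow : Nesting.depthIn red 0 N < m) where

  open Nesting red

  level : ℕ → ℕ → ℕ
  level a b = depthIn (suc a) b

  level<m : ∀ a {b} → b ≤ N → level a b < m
  level<m a b≤N = ≤-<-trans (depthIn-mono {lo′ = suc a} z≤n b≤N) shallow

  Forward : ℕ → ℕ → ℕ → Set
  Forward a ℓ b = red a b ≡ true × level a b ≡ ℓ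

  forward? : ∀ a ℓ → Decidable (Forward a ℓ)
  forward? a ℓ b = red a b Bool.≟ true ×-dec level a b ≟ ℓ

  fwd : ℕ → ℕ → ℕ
  fwd a ℓ = firstFrom (forward? a ℓ) (suc a) (N ∸ suc a)

  Backward : ℕ → ℕ → ℕ → Set
  Backward b ℓ a = Forward a ℓ b × fwd a ℓ ≢ b

  backward? : ∀ b ℓ → Decidable (Backward b ℓ)
  backward? b ℓ a = forward? a ℓ b ×-dec ¬? (fwd a ℓ ≟ b)

  bwd : ℕ → ℕ → ℕ
  bwd b ℓ = lastBelow (backward? b ℓ) b

  fwd-unblocked : ∀ {a a′ b} → a < a′ → a′ < b → b < N → Forward a′ (level a b) b → fwd a′ (level a b) ≡ b
  fwd-unblocked {a} {a′} {b} a<a′ a′<b b<N forward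
    with firstFrom-spec (forward? a′ (level a b)) (suc a′) (N ∸ suc a′) a′<b
           (subst (b <_) (sym (m+[n∸m]≡n (<-trans a′<b b<N))) b<N) forward
  ... | a′<b′ , b′≤b , (red-a′b′ , level≡) with m≤n⇒m<n∨m≡n b′≤b
  ...   | inj₂ b′≡b = b′≡b
  ...   | inj₁ b′<b = contradiction (≤-reflexive (sym level≡)) (<⇒≱ (depthIn-edge a<a′ a′<b′ b′<b red-a′b′))

  fwd-or-bwd : ∀ {a b} → a < b → b < N → red a b ≡ true → fwd a (level a b) ≡ b ⊎ bwd b (level a b) ≡ a
  fwd-or-bwd {a} {b} a<b b<N red-ab with fwd a (level a b) ≟ b
  ... | yes fwd≡b = inj₁ fwd≡b
  ... | no fwd≢b with lastBelow-spec (backward? b (level a b)) b a<b ((red-ab , refl) , fwd≢b)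
  ...   | a≤bwd , bwd<b , (forward , fwd≢b′) with m≤n⇒m<n∨m≡n a≤bwd
  ...     | inj₂ a≡bwd = inj₂ (sym a≡bwd)
  ...     | inj₁ a<bwd = contradiction (fwd-unblocked a<bwd bwd<b b<N forward) fwd≢b′

  fwdMark bwdMark : Fin N → Fin N → Fin m → ℕ
  fwdMark v u ℓ = [ toℕ u ≟ fwd (toℕ v) (toℕ ℓ) ]
  bwdMark v u ℓ = [ toℕ u ≟ bwd (toℕ v) (toℕ ℓ) ]

  marks : Fin N → Fin N → ℕ
  marks v u = ∑[ ℓ < m ] (fwdMark v u ℓ + bwdMark v u ℓ)

  marks-row : ∀ v → ∑[ u < N ] marks v u ≤ m * 2
  marks-row v = begin
    ∑[ u < N ] marks v u                                     ≡⟨ ∑-comm (λ u ℓ → fwdMark v u ℓ + bwdMark v u ℓ) ⟩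
    ∑[ ℓ < m ] ∑[ u < N ] (fwdMark v u ℓ + bwdMark v u ℓ)      ≤⟨ ∑-mono-≤ two-marks ⟩
    ∑[ ℓ < m ] 2                                               ≡⟨ ∑-const m 2 ⟩
    m * 2                                                      ∎
    where
    open ≤-Reasoning
    two-marks : ∀ ℓ → ∑[ u < N ] (fwdMark v u ℓ + bwdMark v u ℓ) ≤ 2
    two-marks ℓ = ≤-trans (≤-reflexive (∑-distrib-+ (λ u → fwdMark v u ℓ) (λ u → bwdMark v u ℓ)))
                          (+-mono-≤ (∑-point N (fwd (toℕ v) (toℕ ℓ))) (∑-point N (bwd (toℕ v) (toℕ ℓ))))

  red-marked : ∀ u v → toℕ u < toℕ v → red (toℕ u) (toℕ v) ≡ true → 0 < marks u v + marks v u
  red-marked u v u<v red-uv = [ via-fwd , via-bwd ]′ (fwd-or-bwd u<v (toℕ<n v) red-uv)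
    where
    ℓ : Fin m
    ℓ = fromℕ< (level<m (toℕ u) (<⇒≤ (toℕ<n v)))
    toℕ-ℓ : toℕ ℓ ≡ level (toℕ u) (toℕ v)
    toℕ-ℓ = toℕ-fromℕ< _
    marked : ∀ x y → 0 < fwdMark x y ℓ + bwdMark x y ℓ → 0 < marks x y
    marked x y pos = ≤-trans pos (term≤∑ (λ ℓ → fwdMark x y ℓ + bwdMark x y ℓ) ℓ)
    via-fwd : fwd (toℕ u) (level (toℕ u) (toℕ v)) ≡ toℕ v → 0 < marks u v + marks v u
    via-fwd fwd≡v = ≤-trans (marked u v (≤-trans (≤-reflexive (sym fwd-mark)) (m≤m+n _ _))) (m≤m+n _ _)
      where
      fwd-mark : fwdMark u v ℓ ≡ 1
      fwd-mark = []-yes (toℕ v ≟ fwd (toℕ u) (toℕ ℓ)) (sym (trans (cong (fwd (toℕ u)) toℕ-ℓ) fwd≡v))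
    via-bwd : bwd (toℕ v) (level (toℕ u) (toℕ v)) ≡ toℕ u → 0 < marks u v + marks v u
    via-bwd bwd≡u = ≤-trans (marked v u (≤-trans (≤-reflexive (sym bwd-mark)) (m≤n+m _ _))) (m≤n+m _ _)
      where
      bwd-mark : bwdMark v u ℓ ≡ 1
      bwd-mark = []-yes (toℕ u ≟ bwd (toℕ v) (toℕ ℓ)) (sym (trans (cong (bwd (toℕ v)) toℕ-ℓ) bwd≡u))

  BlueClique : ℕ → Set
  BlueClique k = Σ (Fin k → Fin N) λ φ → (∀ i j → i <ᶠ j → φ i <ᶠ φ j) ×
                                         (∀ i j → i <ᶠ j → red (toℕ (φ i)) (toℕ (φ j)) ≡ false)

  blue-clique : ∀ n → suc n * suc (2 * (m * 2)) ≤ N → BlueClique (suc n)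
  blue-clique n big =
    clique (large-separated marks marks-row (suc n) (λ _ → yes tt) (≤-trans big (≤-reflexive (sym everyone))))
    where
    everyone : ∑[ u < N ] 1 ≡ N
    everyone = trans (∑-const N 1) (*-identityʳ N)
    clique : LargeSeparated marks marks-row (λ _ → ⊤) (suc n) → BlueClique (suc n)
    clique separatedSet =
      let φ , mono , inX = ascending X? (suc n) large
          no-marks : ∀ i j → i <ᶠ j → marks (φ i) (φ j) + marks (φ j) (φ i) ≡ 0
          no-marks i j i<j = cong₂ _+_ (separated (inX i) (inX j) (<⇒≢ (mono i j i<j)))
                                       (separated (inX j) (inX i) (>⇒≢ (mono i j i<j)))
      in φ , mono , λ i j i<j → Bool.¬-not λ red-ij →
           <-irrefl (sym (no-marks i j i<j)) (red-marked (φ i) (φ j) (mono i j i<j) red-ij)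
      where open LargeSeparated separatedSet

-- The upper bound

2*m≡m+m : ∀ m → 2 * m ≡ m + m
2*m≡m+m m = cong (m +_) (+-identityʳ m)

mirror-< : ∀ {m j} → m ≤ j → j < 2 * m → 2 * m ∸ suc j < m
mirror-< {m} {j} m≤j j<2m = +-cancelʳ-< (suc j) _ _ (begin-strict
  2 * m ∸ suc j + suc j  ≡⟨ m∸n+n≡m j<2m ⟩
  2 * m                  ≡⟨ 2*m≡m+m m ⟩
  m + m                  <⟨ +-monoʳ-< m (s≤s m≤j) ⟩
  m + suc j              ∎)
  where open ≤-Reasoning

mirror-anti : ∀ {m i j} → i < j → j < 2 * m → 2 * m ∸ suc j < 2 * m ∸ suc i
mirror-anti i<j j<2m = ∸-monoʳ-< (s≤s i<j) j<2m

nm-edge-left : ∀ {m i j} → i < j → i + j + 1 ≡ 2 * m → i < m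
nm-edge-left {m} {i} {j} i<j edge = ≰⇒> λ m≤i → <-irrefl refl (begin-strict
  m + m      ≤⟨ +-mono-≤ m≤i (≤-trans m≤i (<⇒≤ i<j)) ⟩
  i + j      <⟨ m<m+n (i + j) z<s ⟩
  i + j + 1  ≡⟨ edge ⟩
  2 * m      ≡⟨ 2*m≡m+m m ⟩
  m + m      ∎)
  where open ≤-Reasoning

nm-edge-right : ∀ {m i j} → i < m → i + j + 1 ≡ 2 * m → m ≤ j
nm-edge-right {m} {i} {j} i<m edge = ≮⇒≥ λ j<m → <-irrefl refl (begin-strict
  m + m      ≡⟨ 2*m≡m+m m ⟨
  2 * m      ≡⟨ edge ⟨
  i + j + 1  ≡⟨ +-comm (i + j) 1 ⟩
  suc i + j  <⟨ +-mono-≤-< i<m j<m ⟩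
  m + m      ∎)
  where open ≤-Reasoning

nm-edge-mirror : ∀ {m i j} → i + j + 1 ≡ 2 * m → 2 * m ∸ suc j ≡ i
nm-edge-mirror {m} {i} {j} edge = begin
  2 * m ∸ suc j      ≡⟨ cong (_∸ suc j) edge ⟨
  i + j + 1 ∸ suc j  ≡⟨ cong (_∸ suc j) (trans (+-assoc i j 1) (cong (i +_) (+-comm j 1))) ⟩
  i + suc j ∸ suc j  ≡⟨ m+n∸n≡m i (suc j) ⟩
  i                  ∎
  where open ≡-Reasoning

module _ {U} (col : Colouring U) where

  private
    colourAt : ∀ {a b} → Dec (a < U) → Dec (b < U) → Bool
    colourAt (yes a<U) (yes b<U) = col (fromℕ< a<U) (fromℕ< b<U)
    colourAt _ _ = false

  -- Out-of-range pairs get the junk colour false.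
  extend : ℕ → ℕ → Bool
  extend a b = colourAt (a <? U) (b <? U)

  extend-toℕ : ∀ i j → extend (toℕ i) (toℕ j) ≡ col i j
  extend-toℕ i j = at (toℕ i <? U) (toℕ j <? U)
    where
    at : (i? : Dec (toℕ i < U)) (j? : Dec (toℕ j < U)) → colourAt i? j? ≡ col i j
    at (yes i<U) (yes j<U) = cong₂ col (fromℕ<-toℕ i i<U) (fromℕ<-toℕ j j<U)
    at (no i≮U) _ = contradiction (toℕ<n i) i≮U
    at (yes _) (no j≮U) = contradiction (toℕ<n j) j≮U

  module _ {m} (nested : Nesting.Nested extend m 0 U) where
    open Nesting extend using (nested-cross)
    open Nesting.Nested nested

    -- Vertex i < m of NM_m is the i-th left endpoint; vertex i ≥ m is the right endpoint
    -- of the edge whose left endpoint is 2m − 1 − i.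
    position : ℕ → ℕ
    position i with i <? m
    ... | yes _ = left i
    ... | no _ = right (2 * m ∸ suc i)

    position-left : ∀ {i} → i < m → position i ≡ left i
    position-left {i} i<m with i <? m
    ... | yes _ = refl
    ... | no i≮m = contradiction i<m i≮m

    position-right : ∀ {i} → m ≤ i → position i ≡ right (2 * m ∸ suc i)
    position-right {i} m≤i with i <? m
    ... | yes i<m = contradiction m≤i (<⇒≱ i<m)
    ... | no _ = refl

    position-mono : ∀ {i j} → i < j → j < 2 * m → position i < position j
    position-mono {i} {j} i<j j<2m with i <? m | j <? m
    ... | yes i<m | yes j<m = left-mono i<j j<m
    ... | yes i<m | no j≮m = nested-cross nested i<m (mirror-< (≮⇒≥ j≮m) j<2m)
    ... | no i≮m | yes j<m = contradiction (<-trans i<j j<m) i≮m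
    ... | no i≮m | no j≮m = right-anti (mirror-anti {m} i<j j<2m) (mirror-< (≮⇒≥ i≮m) (<-trans i<j j<2m))

    position<U : ∀ {i} → i < 2 * m → position i < U
    position<U {i} i<2m with i <? m
    ... | yes i<m = <-trans (left<right i<m) (right<hi i<m)
    ... | no i≮m = right<hi (mirror-< (≮⇒≥ i≮m) i<2m)

    nested-copy : MonoCopy col true (NM< m)
    nested-copy = φ , mono , edges
      where
      φ : Fin (2 * m) → Fin U
      φ i = fromℕ< (position<U (toℕ<n i))
      toℕ-φ : ∀ i → toℕ (φ i) ≡ position (toℕ i)
      toℕ-φ i = toℕ-fromℕ< _
      mono : ∀ i j → i <ᶠ j → φ i <ᶠ φ j
      mono i j i<j = subst₂ _<_ (sym (toℕ-φ i)) (sym (toℕ-φ j)) (position-mono i<j (toℕ<n j))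
      edges : ∀ i j → i <ᶠ j → NM< m i j → col (φ i) (φ j) ≡ true
      edges i j i<j edge = begin
        col (φ i) (φ j)                                     ≡⟨ extend-toℕ (φ i) (φ j) ⟨
        extend (toℕ (φ i)) (toℕ (φ j))                      ≡⟨ cong₂ extend (toℕ-φ i) (toℕ-φ j) ⟩
        extend (position (toℕ i)) (position (toℕ j))        ≡⟨ cong₂ extend (position-left i<m) (position-right m≤j) ⟩
        extend (left (toℕ i)) (right (2 * m ∸ suc (toℕ j))) ≡⟨ cong (extend (left (toℕ i)) ∘ right) mirror ⟩
        extend (left (toℕ i)) (right (toℕ i))               ≡⟨ red-edge i<m ⟩
        true                                                ∎
        where
        open ≡-Reasoning
        i<m : toℕ i < m
        i<m = nm-edge-left i<j edge
        m≤j : m ≤ toℕ j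
        m≤j = nm-edge-right i<m edge
        mirror : 2 * m ∸ suc (toℕ j) ≡ toℕ i
        mirror = nm-edge-mirror {m} edge

arrows-upper : ∀ m n {U} → suc n * suc (2 * (m * 2)) ≤ U → Arrows U (NM< m) (K< (suc n))
arrows-upper m n {U} big col = by-depth (m ≤? depthIn 0 U)
  where
  open Nesting (extend col) using (depthIn; depth-nested)
  by-depth : Dec (m ≤ depthIn 0 U) → MonoCopy col true (NM< m) ⊎ MonoCopy col false (K< (suc n))
  by-depth (yes deep) = inj₁ (nested-copy col (depth-nested 0 U m deep))
  by-depth (no shallow) =
    let ψ , mono , blue = Levels.blue-clique (extend col) (≰⇒> shallow) n big
    in inj₂ (ψ , mono , λ i j i<j _ → trans (sym (extend-toℕ col (ψ i) (ψ j))) (blue i j i<j))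

arrows-lower : ∀ {m n r} → 1 ≤ m → Arrows r (NM< m) (K< (suc n)) → m * n < r
arrows-lower {m} {n} m≥1 arrows = ≰⇒> λ r≤mn → ¬arrows-small m≥1 (≤-trans r≤mn (≤-reflexive (*-comm m n))) arrows

upper-size : ∀ {m n} → 1 ≤ m → 1 ≤ n → suc n * suc (2 * (m * 2)) ≤ 10 * (m * n)
upper-size {m} {n} m≥1 n≥1 = begin
  suc n * suc (2 * (m * 2))  ≤⟨ *-mono-≤ (+-monoˡ-≤ n n≥1) (+-monoˡ-≤ (2 * (m * 2)) m≥1) ⟩
  (n + n) * (m + 2 * (m * 2)) ≡⟨ ten m n ⟩
  10 * (m * n)               ∎
  where
  open ≤-Reasoning
  ten : ∀ m n → (n + n) * (m + 2 * (m * 2)) ≡ 10 * (m * n)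
  ten = solve-∀

nm? : ∀ m i j → Dec (NM< m i j)
nm? m i j = toℕ i + toℕ j + 1 ≟ 2 * m

theorem10 : Σ ℕ λ A → Σ ℕ λ B → 1 ≤ A × 1 ≤ B ×
    (∀ m n → 1 ≤ m → 1 ≤ n →
    Σ ℕ λ r → IsOrdRamsey (NM< m) (K< (suc n)) r ×
    (m * n ≤ A * r) × (r ≤ B * (m * n)))
theorem10 = 1 , 10 , s≤s z≤n , s≤s z≤n , λ m n m≥1 n≥1 →
  let r , ramsey@(arrows , _) , r≤U = ordRamsey-exists (nm? m) (λ _ _ → yes tt) _ (arrows-upper m n ≤-refl)
  in r , ramsey ,
     ≤-trans (<⇒≤ (arrows-lower m≥1 arrows)) (≤-reflexive (sym (*-identityˡ r))) ,
     ≤-trans r≤U (upper-size m≥1 n≥1)
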